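{- Let $K$ be a finite complete graph whose edges are colored by elements of a finite set $\Gamma$, and let $S$ be the set of integers $n\ge 2$ such that $K$ contains no colorful $n$-cycle. If $3\in S$, then $S=\{2,3,4,\dots\}$. In other words, if a complete colored graph contains no colorful triangle, then it contains no colorful cycle of any length.
   Context: An $n$-cycle ($n\geq 2$) is a sequence $(v_1,\dots,v_n)$ of distinct vertices, with edges $v_iv_{i+1}$, indices mod $n$; a triangle is a 3-cycle. A cycle in an edge-colored graph is colorful if its edges have pairwise distinct colors. -}

module Defs where

open import Data.Nat using (ℕ; suc)
open import Data.Nat.DivMod using (m%n<n; _%_)
open import Data.Fin using (Fin; toℕ; fromℕ<)
open import Data.Product using (Σ; _×_)
open import Function.Definitions using (Injective)
open import Relation.Binary.PropositionalEquality using (_≡_)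

-- An edge-colouring of the complete graph on vertex set Fin m with
-- colours from the finite set Γ = Fin k: a colour for each unordered pair,
-- encoded as a symmetric function (its value on the diagonal is irrelevant).
record EdgeColouring (m k : ℕ) : Set where
  field
    col : Fin m → Fin m → Fin k
    sym : ∀ u v → col u v ≡ col v u
open EdgeColouring public

next : {n : ℕ} → Fin n → Fin n
next {suc p} i = fromℕ< (m%n<n (suc (toℕ i)) (suc p))

-- an n-cycle in K_m: n distinct vertices v_0,…,v_{n-1}, with edges v_i v_{i+1} (indices mod n)
-- (every such sequence is a cycle since the graph is complete).
ColorfulCycle : {m k : ℕ} → EdgeColouring m k → (n : ℕ) → Set
ColorfulCycle {m} K n =
  Σ (Fin n → Fin m) λ v →
    Injective _≡_ _≡_ v × Injective _≡_ _≡_ (λ i → col K (v i) (v (next i)))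

-- Delete v₁ from a colourful cycle v₀ v₁ v₂ … and close it up with the chord v₀v₂.
-- The triangle v₀v₁v₂ is not colourful, so the chord repeats the colour of v₀v₁ or
-- of v₁v₂; both colours have just left the cycle, so the shorter cycle is again
-- colourful. Iterating ends at a colourful 2-cycle, which is impossible because
-- its two edges are the same edge.
module Submission where

open import Defs renaming (sym to col-sym)
open import Data.Nat using (ℕ; _≥_; zero; suc; s≤s; z≤n; _%_)
open import Data.Nat.DivMod using (m<n⇒m%n≡m; n%n≡0)
open import Data.Fin using (Fin; zero; suc; toℕ; fromℕ; inject₁; punchIn)
open import Data.Fin.Properties
  using (toℕ-injective; toℕ-fromℕ<; toℕ-fromℕ; toℕ-inject₁; toℕ<n; suc-injective; punchIn-injective)
open import Data.Fin.Relation.Unary.Top using (view; ‵fromℕ; ‵inject₁)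
open import Data.Vec.Functional using (_∷_; [])
open import Data.Product using (_,_)
open import Function using (_∘_)
open import Function.Definitions using (Injective)
open import Relation.Nullary using (¬_)
open import Relation.Binary.PropositionalEquality
  using (_≡_; _≢_; _≗_; refl; sym; trans; cong; module ≡-Reasoning)

next-inject₁ : ∀ {n} (i : Fin n) → next (inject₁ i) ≡ suc i
next-inject₁ {n} i = toℕ-injective (begin
  toℕ (next (inject₁ i))        ≡⟨ toℕ-fromℕ< _ ⟩
  suc (toℕ (inject₁ i)) % suc n ≡⟨ cong (λ t → suc t % suc n) (toℕ-inject₁ i) ⟩
  suc (toℕ i) % suc n           ≡⟨ m<n⇒m%n≡m (s≤s (toℕ<n i)) ⟩
  suc (toℕ i)                   ∎)
  where open ≡-Reasoning

next-fromℕ : ∀ n → next (fromℕ n) ≡ zero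
next-fromℕ n = toℕ-injective (begin
  toℕ (next (fromℕ n))        ≡⟨ toℕ-fromℕ< _ ⟩
  suc (toℕ (fromℕ n)) % suc n ≡⟨ cong (λ t → suc t % suc n) (toℕ-fromℕ n) ⟩
  suc n % suc n               ≡⟨ n%n≡0 (suc n) ⟩
  0                           ∎)
  where open ≡-Reasoning

next-punchIn₁ : ∀ {p} (j : Fin (suc p)) → next (punchIn (suc zero) (suc j)) ≡ punchIn (suc zero) (next (suc j))
next-punchIn₁ {p} j with view j
... | ‵fromℕ = trans (next-fromℕ (suc (suc p))) (cong (punchIn (suc zero)) (sym (next-fromℕ (suc p))))
... | ‵inject₁ i = trans (next-inject₁ (suc (suc i))) (cong (punchIn (suc zero)) (sym (next-inject₁ (suc i))))

module _ {a} {A : Set a} where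

  injective-Fin3 : (f : Fin 3 → A) →
    f zero ≢ f (suc zero) → f (suc zero) ≢ f (suc (suc zero)) → f (suc (suc zero)) ≢ f zero →
    Injective _≡_ _≡_ f
  injective-Fin3 f f₀≢f₁ f₁≢f₂ f₂≢f₀ = inj
    where
    inj : Injective _≡_ _≡_ f
    inj {zero}             {zero}             _ = refl
    inj {zero}             {suc zero}         e with () ← f₀≢f₁ e
    inj {zero}             {suc (suc zero)}   e with () ← f₂≢f₀ (sym e)
    inj {suc zero}         {zero}             e with () ← f₀≢f₁ (sym e)
    inj {suc zero}         {suc zero}         _ = refl
    inj {suc zero}         {suc (suc zero)}   e with () ← f₁≢f₂ e
    inj {suc (suc zero)}   {zero}             e with () ← f₂≢f₀ e
    inj {suc (suc zero)}   {suc zero}         e with () ← f₁≢f₂ (sym e)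
    inj {suc (suc zero)}   {suc (suc zero)}   _ = refl

  injective-∷ : ∀ {n} (x : A) (f : Fin n → A) →
    (∀ j → x ≢ f j) → Injective _≡_ _≡_ f → Injective _≡_ _≡_ (x ∷ f)
  injective-∷ x f fresh f-inj {zero}  {zero}  _ = refl
  injective-∷ x f fresh f-inj {zero}  {suc j} e with () ← fresh j e
  injective-∷ x f fresh f-inj {suc i} {zero}  e with () ← fresh i (sym e)
  injective-∷ x f fresh f-inj {suc i} {suc j} e = cong suc (f-inj e)

  injective-resp-≗ : ∀ {n} {f g : Fin n → A} → f ≗ g → Injective _≡_ _≡_ g → Injective _≡_ _≡_ f
  injective-resp-≗ {f = f} {g} f≗g g-inj {i} {j} e = g-inj (trans (sym (f≗g i)) (trans e (f≗g j)))

module _ {m k : ℕ} (K : EdgeColouring m k) where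

  noColorfulDigon : ¬ ColorfulCycle K 2
  noColorfulDigon (v , _ , e-inj) with () ← e-inj {zero} {suc zero} (col-sym K (v zero) (v (suc zero)))

  colorfulTriangle : (a b c : Fin m) → a ≢ b → b ≢ c → c ≢ a →
    col K a b ≢ col K b c → col K b c ≢ col K c a → col K c a ≢ col K a b →
    ColorfulCycle K 3
  colorfulTriangle a b c ab bc ca e₁ e₂ e₃ =
    (a ∷ b ∷ c ∷ []) , injective-Fin3 _ ab bc ca , injective-Fin3 _ e₁ e₂ e₃

  colorfulCycle-shortcut : ∀ {p} → ¬ ColorfulCycle K 3 →
    ColorfulCycle K (suc (suc (suc p))) → ColorfulCycle K (suc (suc p))
  colorfulCycle-shortcut {p} no3 (v , v-inj , e-inj) = w , punchIn-injective (suc zero) _ _ ∘ v-inj , w-edge-inj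
    where
    e : Fin (suc (suc (suc p))) → Fin k
    e i = col K (v i) (v (next i))

    v₀ v₁ v₂ : Fin m
    v₀ = v zero
    v₁ = v (suc zero)
    v₂ = v (suc (suc zero))

    chord : Fin k
    chord = col K v₀ v₂

    w : Fin (suc (suc p)) → Fin m
    w = v ∘ punchIn (suc zero)

    w-edge : Fin (suc (suc p)) → Fin k
    w-edge i = col K (w i) (w (next i))

    e-tail : Fin (suc p) → Fin k
    e-tail j = e (suc (suc j))

    e₀ : e zero ≡ col K v₀ v₁
    e₀ = cong (col K v₀ ∘ v) (next-inject₁ zero)
    e₁ : e (suc zero) ≡ col K v₁ v₂
    e₁ = cong (col K v₁ ∘ v) (next-inject₁ (suc zero))

    vertex-distinct : ∀ {i j} → i ≢ j → v i ≢ v j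
    vertex-distinct i≢j = i≢j ∘ v-inj

    edge-distinct : ∀ {i j} → i ≢ j → e i ≢ e j
    edge-distinct i≢j = i≢j ∘ e-inj

    chord-fresh : ∀ j → chord ≢ e-tail j
    chord-fresh j chord≡eⱼ = no3 (colorfulTriangle v₀ v₁ v₂
      (vertex-distinct (λ ())) (vertex-distinct (λ ())) (vertex-distinct (λ ()))
      (λ h → edge-distinct {zero} {suc zero} (λ ()) (trans e₀ (trans h (sym e₁))))
      (λ h → edge-distinct {suc zero} {suc (suc j)} (λ ()) (trans e₁ (trans h c₂₀)))
      (λ h → edge-distinct {zero} {suc (suc j)} (λ ()) (trans e₀ (trans (sym h) c₂₀))))
      where
      c₂₀ : col K v₂ v₀ ≡ e-tail j
      c₂₀ = trans (col-sym K v₂ v₀) chord≡eⱼ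

    w-edge≗ : w-edge ≗ (chord ∷ e-tail)
    w-edge≗ zero = cong (col K v₀ ∘ w) (next-inject₁ zero)
    w-edge≗ (suc j) = cong (col K (w (suc j)) ∘ v) (sym (next-punchIn₁ j))

    w-edge-inj : Injective _≡_ _≡_ w-edge
    w-edge-inj = injective-resp-≗ w-edge≗
      (injective-∷ chord e-tail chord-fresh (suc-injective ∘ suc-injective ∘ e-inj))

mainTheorem2 : (m k : ℕ) (K : EdgeColouring m k) →
    ¬ ColorfulCycle K 3 →
    (n : ℕ) → n ≥ 2 → ¬ ColorfulCycle K n
mainTheorem2 m k K no3 (suc zero) (s≤s ())
mainTheorem2 m k K no3 (suc (suc zero)) _ = noColorfulDigon K
mainTheorem2 m k K no3 (suc (suc (suc p))) _ =
  mainTheorem2 m k K no3 (suc (suc p)) (s≤s (s≤s z≤n)) ∘ colorfulCycle-shortcut K no3
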